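{- Let $p$ be an odd prime and $s$ a positive integer. Then \[ \sum_{\substack{2\le x_1,\dots,x_s\le p-1\\ 2\le y_1,\dots,y_s\le p-1\\ \prod_{i=1}^{s}x_i\equiv \prod_{i=1}^{s}y_i \ (\mathrm{mod}\ p)}}\chi_0\!\left(\prod_{i=1}^{s}x_i-1\right) =(p-2)\left(\frac{(p-2)^s-(-1)^s}{p-1}\right)^2 . \]
   Context: $\chi_0$ denotes the principal Dirichlet character modulo $p$: $\chi_0(n)=1$ if $p\nmid n$ and $\chi_0(n)=0$ if $p\mid n$. -}

module Defs where

open import Data.Nat using (ℕ; zero; suc; _∸_; _+_; _*_; _≟_)
open import Data.Nat.DivMod using (_%_)
open import Data.Nat.Divisibility using (_∣?_)
open import Data.List using (List; []; _∷_; map; concatMap; upTo)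
open import Data.Nat.ListAction using (sum)
open import Data.Vec using (Vec; []; _∷_; foldr)
open import Relation.Nullary using (Dec; yes; no)

range2 : ℕ → List ℕ
range2 p = map (2 +_) (upTo (p ∸ 2))

tuples : (s : ℕ) → List ℕ → List (Vec ℕ s)
tuples zero    xs = [] ∷ []
tuples (suc s) xs = concatMap (λ x → map (x ∷_) (tuples s xs)) xs

prodV : ∀ {s} → Vec ℕ s → ℕ
prodV = foldr _ _*_ 1

χ₀ : ℕ → ℕ → ℕ
χ₀ p n with p ∣? n
... | yes _ = 0
... | no  _ = 1

open import Relation.Binary.PropositionalEquality using (_≡_)

CongMod : ℕ → ℕ → ℕ → Set
CongMod zero    a b = a ≡ b
CongMod (suc q) a b = a % suc q ≡ b % suc q

congMod? : (p a b : ℕ) → Dec (CongMod p a b)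
congMod? zero    a b = a ≟ b
congMod? (suc q) a b = (a % suc q) ≟ (b % suc q)

lhs : ℕ → ℕ → ℕ
lhs p s = sum (map (λ x → sum (map (λ y → term x y) T)) T)
  where
  T = tuples s (range2 p)
  term : Vec ℕ s → Vec ℕ s → ℕ
  term x y with congMod? p (prodV x) (prodV y)
  ... | yes _ = χ₀ p (prodV x ∸ 1)
  ... | no  _ = 0

module Submission where

-- Let N_s(a) be the number of s-tuples over {2, …, p−1} whose product is ≡ a (mod p).
-- Grouping the double sum by the common residue a of the two products turns it into
-- Σ_a N_s(a)² χ₀(a − 1), in which N_s(0) = 0 and the term a = 1 vanishes. Multiplication
-- by a unit permutes the nonzero residues, so extending a tuple by a coordinate
-- x ∈ {1, …, p−1} reaches every nonzero residue exactly once; reading x = 1 as "no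
-- extension" gives N_{s+1}(a) + N_s(a) = (p−2)^s for 2 ≤ a ≤ p−1. Hence N_s(a) is the
-- same for all such a, and solving the recurrence gives (p−1) N_s(a) = (p−2)^s − (−1)^s.

open import Defs
open import Data.Nat using (ℕ; suc; _∸_; _<_)
open import Data.Nat.Primality using (Prime)

module Sums where
  open import Data.Nat
  open import Data.Nat.Properties
  open import Data.Nat.ListAction using (sum)
  open import Data.Nat.ListAction.Properties using (sum-++)
  open import Data.List using (List; []; _∷_; _++_; map; concatMap; applyUpTo; upTo; length)
  open import Data.List.Properties using (map-++; map-∘; map-cong; map-cong-local)
  open import Data.List.Relation.Unary.All using (All)
  open import Algebra.Properties.CommutativeSemigroup +-commutativeSemigroup using (interchange)
  open import Relation.Binary.PropositionalEquality
  open import Function using (_∘_)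

  private variable
    A B : Set

  ∑ : List A → (A → ℕ) → ℕ
  ∑ xs f = sum (map f xs)

  ∑-cong : ∀ (xs : List A) {f g : A → ℕ} → f ≗ g → ∑ xs f ≡ ∑ xs g
  ∑-cong xs f≗g = cong sum (map-cong f≗g xs)

  ∑-cong-local : ∀ {xs : List A} {f g : A → ℕ} → All (λ x → f x ≡ g x) xs → ∑ xs f ≡ ∑ xs g
  ∑-cong-local eqs = cong sum (map-cong-local eqs)

  ∑-map : ∀ (g : A → B) xs (f : B → ℕ) → ∑ (map g xs) f ≡ ∑ xs (f ∘ g)
  ∑-map g xs f = cong sum (sym (map-∘ xs))

  ∑-++ : ∀ (xs ys : List A) (f : A → ℕ) → ∑ (xs ++ ys) f ≡ ∑ xs f + ∑ ys f
  ∑-++ xs ys f = trans (cong sum (map-++ f xs ys)) (sum-++ (map f xs) (map f ys))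

  ∑-concatMap : ∀ (g : A → List B) xs (f : B → ℕ) → ∑ (concatMap g xs) f ≡ ∑ xs (λ x → ∑ (g x) f)
  ∑-concatMap g []       f = refl
  ∑-concatMap g (x ∷ xs) f =
    trans (∑-++ (g x) (concatMap g xs) f) (cong (∑ (g x) f +_) (∑-concatMap g xs f))

  ∑-const : ∀ (xs : List A) c → ∑ xs (λ _ → c) ≡ length xs * c
  ∑-const []       c = refl
  ∑-const (x ∷ xs) c = cong (c +_) (∑-const xs c)

  ∑-+ : ∀ (xs : List A) (f g : A → ℕ) → ∑ xs (λ x → f x + g x) ≡ ∑ xs f + ∑ xs g
  ∑-+ []       f g = refl
  ∑-+ (x ∷ xs) f g =
    trans (cong (f x + g x +_) (∑-+ xs f g)) (interchange (f x) (g x) (∑ xs f) (∑ xs g))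

  ∑-*ʳ : ∀ (xs : List A) (f : A → ℕ) c → ∑ xs (λ x → f x * c) ≡ ∑ xs f * c
  ∑-*ʳ []       f c = refl
  ∑-*ʳ (x ∷ xs) f c =
    trans (cong (f x * c +_) (∑-*ʳ xs f c)) (sym (*-distribʳ-+ c (f x) (∑ xs f)))

  ∑-swap : ∀ (xs : List A) (ys : List B) (f : A → B → ℕ) →
           ∑ xs (λ x → ∑ ys (f x)) ≡ ∑ ys (λ y → ∑ xs (λ x → f x y))
  ∑-swap []       ys f = sym (trans (∑-const ys 0) (*-zeroʳ (length ys)))
  ∑-swap (x ∷ xs) ys f =
    trans (cong (∑ ys (f x) +_) (∑-swap xs ys f)) (sym (∑-+ ys (f x) (λ y → ∑ xs (λ x′ → f x′ y))))

  ∑< : ℕ → (ℕ → ℕ) → ℕ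
  ∑< zero    h = 0
  ∑< (suc n) h = h 0 + ∑< n (h ∘ suc)

  ∑-applyUpTo : ∀ (g : ℕ → ℕ) n (h : ℕ → ℕ) → ∑ (applyUpTo g n) h ≡ ∑< n (h ∘ g)
  ∑-applyUpTo g zero    h = refl
  ∑-applyUpTo g (suc n) h = cong (h (g 0) +_) (∑-applyUpTo (g ∘ suc) n h)

  ∑-upTo : ∀ n (h : ℕ → ℕ) → ∑ (upTo n) h ≡ ∑< n h
  ∑-upTo = ∑-applyUpTo (λ i → i)

  ∑<-cong : ∀ n {h k : ℕ → ℕ} → (∀ {i} → i < n → h i ≡ k i) → ∑< n h ≡ ∑< n k
  ∑<-cong zero    eq = refl
  ∑<-cong (suc n) eq = cong₂ _+_ (eq z<s) (∑<-cong n (eq ∘ s<s))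

  ∑<-const : ∀ n c → ∑< n (λ _ → c) ≡ n * c
  ∑<-const zero    c = refl
  ∑<-const (suc n) c = cong (c +_) (∑<-const n c)

  ∑<-zero : ∀ n {h : ℕ → ℕ} → (∀ {i} → i < n → h i ≡ 0) → ∑< n h ≡ 0
  ∑<-zero n eq = trans (∑<-cong n eq) (trans (∑<-const n 0) (*-zeroʳ n))

  ∑<-≤n : ∀ n {h : ℕ → ℕ} → (∀ {i} → i < n → h i ≤ 1) → ∑< n h ≤ n
  ∑<-≤n zero    le = z≤n
  ∑<-≤n (suc n) le = +-mono-≤ (le z<s) (∑<-≤n n (le ∘ s<s))

  ∑-∑<-swap : ∀ (xs : List A) n (F : A → ℕ → ℕ) →
              ∑ xs (λ x → ∑< n (F x)) ≡ ∑< n (λ a → ∑ xs (λ x → F x a))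
  ∑-∑<-swap xs n F = begin
    ∑ xs (λ x → ∑< n (F x))               ≡⟨ ∑-cong xs (λ x → sym (∑-upTo n (F x))) ⟩
    ∑ xs (λ x → ∑ (upTo n) (F x))         ≡⟨ ∑-swap xs (upTo n) F ⟩
    ∑ (upTo n) (λ a → ∑ xs (λ x → F x a)) ≡⟨ ∑-upTo n _ ⟩
    ∑< n (λ a → ∑ xs (λ x → F x a))       ∎
    where open ≡-Reasoning

  ∑<-swap : ∀ m n (F : ℕ → ℕ → ℕ) → ∑< m (λ i → ∑< n (F i)) ≡ ∑< n (λ a → ∑< m (λ i → F i a))
  ∑<-swap m n F = begin
    ∑< m (λ i → ∑< n (F i))               ≡⟨ sym (∑-upTo m _) ⟩
    ∑ (upTo m) (λ i → ∑< n (F i))         ≡⟨ ∑-∑<-swap (upTo m) n F ⟩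
    ∑< n (λ a → ∑ (upTo m) (λ i → F i a)) ≡⟨ ∑<-cong n (λ _ → ∑-upTo m _) ⟩
    ∑< n (λ a → ∑< m (λ i → F i a))       ∎
    where open ≡-Reasoning

module Fibres where
  open import Data.Nat
  open import Data.Nat.Properties
  open import Data.List using (List)
  open import Relation.Binary.PropositionalEquality
  open import Relation.Nullary using (yes; no; contradiction)
  open import Function using (_∘_)
  open Sums

  -- By recursion rather than via _≟_, so that δ (suc a) (suc b) reduces to δ a b.
  δ : ℕ → ℕ → ℕ
  δ zero    zero    = 1
  δ zero    (suc b) = 0
  δ (suc a) zero    = 0
  δ (suc a) (suc b) = δ a b

  δ-refl : ∀ a → δ a a ≡ 1
  δ-refl zero    = refl
  δ-refl (suc a) = δ-refl a

  δ-≢ : ∀ {a b} → a ≢ b → δ a b ≡ 0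
  δ-≢ {zero}  {zero}  a≢b = contradiction refl a≢b
  δ-≢ {zero}  {suc b} a≢b = refl
  δ-≢ {suc a} {zero}  a≢b = refl
  δ-≢ {suc a} {suc b} a≢b = δ-≢ (a≢b ∘ cong suc)

  ∑<-δ : ∀ {n v} (φ : ℕ → ℕ) → v < n → ∑< n (λ a → δ a v * φ a) ≡ φ v
  ∑<-δ {suc n} {zero}  φ _ =
    trans (cong₂ _+_ (+-identityʳ (φ 0)) (∑<-zero n (λ _ → refl))) (+-identityʳ (φ 0))
  ∑<-δ {suc n} {suc v} φ (s<s v<n) = ∑<-δ (φ ∘ suc) v<n

  Injective< : ℕ → (ℕ → ℕ) → Set
  Injective< n σ = ∀ {i j} → i < n → j < n → σ i ≡ σ j → i ≡ j

  fibre : ℕ → (ℕ → ℕ) → ℕ → ℕ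
  fibre n σ a = ∑< n (λ i → δ a (σ i))

  fibre-≤1 : ∀ n {σ} → Injective< n σ → ∀ a → fibre n σ a ≤ 1
  fibre-≤1 zero    inj a = z≤n
  fibre-≤1 (suc n) {σ} inj a with a ≟ σ 0
  ... | yes refl rewrite δ-refl (σ 0) =
    ≤-reflexive (cong suc (∑<-zero n (λ i<n → δ-≢ (λ σ0≡σi → 0≢1+n (inj z<s (s<s i<n) σ0≡σi)))))
  ... | no a≢σ0  rewrite δ-≢ a≢σ0 =
    fibre-≤1 n (λ i<n j<n σi≡σj → suc-injective (inj (s<s i<n) (s<s j<n) σi≡σj)) a

  fibre-total : ∀ n {σ} → (∀ {i} → i < n → σ i < n) → ∑< n (fibre n σ) ≡ n
  fibre-total n {σ} σ<n = begin
    ∑< n (λ a → ∑< n (λ i → δ a (σ i))) ≡⟨ ∑<-swap n n (λ a i → δ a (σ i)) ⟩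
    ∑< n (λ i → ∑< n (λ a → δ a (σ i))) ≡⟨ ∑<-cong n (λ i<n → singleton (σ<n i<n)) ⟩
    ∑< n (λ _ → 1)                      ≡⟨ ∑<-const n 1 ⟩
    n * 1                               ≡⟨ *-identityʳ n ⟩
    n                                   ∎
    where
    open ≡-Reasoning
    singleton : ∀ {v} → v < n → ∑< n (λ a → δ a v) ≡ 1
    singleton v<n = trans (∑<-cong n (λ _ → sym (*-identityʳ _))) (∑<-δ (λ _ → 1) v<n)

  ∑<≡n⇒≡1 : ∀ n {h : ℕ → ℕ} → (∀ {i} → i < n → h i ≤ 1) → ∑< n h ≡ n →
            ∀ {i} → i < n → h i ≡ 1
  ∑<≡n⇒≡1 (suc n) {h} h≤1 total {i} i<n = pointwise i i<n
    where
    rest : ℕ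
    rest = ∑< n (h ∘ suc)
    head≡1 : h 0 ≡ 1
    head≡1 = ≤-antisym (h≤1 z<s) (+-cancelʳ-≤ n 1 (h 0) (begin
      1 + n      ≡⟨ sym total ⟩
      h 0 + rest ≤⟨ +-monoʳ-≤ (h 0) (∑<-≤n n (h≤1 ∘ s<s)) ⟩
      h 0 + n    ∎))
      where open ≤-Reasoning
    rest≡n : rest ≡ n
    rest≡n = suc-injective (trans (cong (_+ rest) (sym head≡1)) total)
    pointwise : ∀ i → i < suc n → h i ≡ 1
    pointwise zero    _         = head≡1
    pointwise (suc i) (s<s i<n) = ∑<≡n⇒≡1 n (h≤1 ∘ s<s) rest≡n i<n

  -- Fibres of an injective map have at most one point and together cover [0, n), so each has one.
  injective⇒fibre≡1 : ∀ n {σ} → (∀ {i} → i < n → σ i < n) → Injective< n σ →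
                      ∀ {a} → a < n → fibre n σ a ≡ 1
  injective⇒fibre≡1 n σ<n inj = ∑<≡n⇒≡1 n (λ {a} _ → fibre-≤1 n inj a) (fibre-total n σ<n)

  ∑-fibres : ∀ {A : Set} (xs : List A) n (r : A → ℕ) → (∀ x → r x < n) → (φ : ℕ → ℕ) →
             ∑ xs (φ ∘ r) ≡ ∑< n (λ a → ∑ xs (λ x → δ a (r x)) * φ a)
  ∑-fibres xs n r r<n φ = begin
    ∑ xs (φ ∘ r)                                 ≡⟨ ∑-cong xs (λ x → sym (∑<-δ φ (r<n x))) ⟩
    ∑ xs (λ x → ∑< n (λ a → δ a (r x) * φ a))    ≡⟨ ∑-∑<-swap xs n (λ x a → δ a (r x) * φ a) ⟩
    ∑< n (λ a → ∑ xs (λ x → δ a (r x) * φ a))    ≡⟨ ∑<-cong n (λ {a} _ → ∑-*ʳ xs (λ x → δ a (r x)) (φ a)) ⟩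
    ∑< n (λ a → ∑ xs (λ x → δ a (r x)) * φ a)    ∎
    where open ≡-Reasoning

module Residues where
  open import Data.Nat
  open import Data.Nat.Properties
  open import Data.Nat.DivMod
  open import Data.Nat.Divisibility
  open import Data.Nat.Primality using (euclidsLemma; prime⇒nonZero; prime⇒nonTrivial)
  open import Data.Sum using ([_,_]; inj₁; inj₂)
  open import Data.Empty using (⊥-elim)
  open import Function using (_∘_; id)
  open import Relation.Binary.PropositionalEquality
  open import Relation.Nullary.Negation using (contradiction)

  %-≡⇒∣∸ : ∀ {n} .{{_ : NonZero n}} m o → m % n ≡ o % n → n ∣ o ∸ m
  %-≡⇒∣∸ {n} m o m%n≡o%n = divides (o / n ∸ m / n) (begin
    o ∸ m                                     ≡⟨ cong₂ _∸_ (m≡m%n+[m/n]*n o n) (m≡m%n+[m/n]*n m n) ⟩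
    (o % n + o / n * n) ∸ (m % n + m / n * n) ≡⟨ cong (λ r → (r + o / n * n) ∸ (m % n + m / n * n)) (sym m%n≡o%n) ⟩
    (m % n + o / n * n) ∸ (m % n + m / n * n) ≡⟨ [m+n]∸[m+o]≡n∸o (m % n) _ _ ⟩
    o / n * n ∸ m / n * n                     ≡⟨ sym (*-distribʳ-∸ n (o / n) (m / n)) ⟩
    (o / n ∸ m / n) * n                       ∎)
    where open ≡-Reasoning

  ∣∧<⇒≡0 : ∀ {m n} → n ∣ m → m < n → m ≡ 0
  ∣∧<⇒≡0 {zero}  _   _   = refl
  ∣∧<⇒≡0 {suc m} n∣m m<n = contradiction n∣m (>⇒∤ m<n)

  module _ {p : ℕ} (isPrime : Prime p) where
    private instance
      p≢0 : NonZero p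
      p≢0 = prime⇒nonZero isPrime

    ∤1 : p ∤ 1
    ∤1 = nonTrivial⇒≢1 {{prime⇒nonTrivial isPrime}} ∘ ∣1⇒≡1

    ∤-* : ∀ {m n} → p ∤ m → p ∤ n → p ∤ m * n
    ∤-* {m} {n} p∤m p∤n p∣mn = [ p∤m , p∤n ] (euclidsLemma m n isPrime p∣mn)

    private
      *%-injective-≤ : ∀ {c} → p ∤ c → ∀ {i j} → i ≤ j → j < p → i * c % p ≡ j * c % p → i ≡ j
      *%-injective-≤ {c} p∤c {i} {j} i≤j j<p eq =
        ≤-antisym i≤j (m∸n≡0⇒m≤n (∣∧<⇒≡0 p∣j∸i (≤-<-trans (m∸n≤m j i) j<p)))
        where
        p∣[j∸i]*c : p ∣ (j ∸ i) * c
        p∣[j∸i]*c = subst (p ∣_) (sym (*-distribʳ-∸ c j i)) (%-≡⇒∣∸ (i * c) (j * c) eq)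
        p∣j∸i : p ∣ j ∸ i
        p∣j∸i = [ id , ⊥-elim ∘ p∤c ] (euclidsLemma (j ∸ i) c isPrime p∣[j∸i]*c)

    *%-injective : ∀ {c} → p ∤ c → ∀ {i j} → i < p → j < p → i * c % p ≡ j * c % p → i ≡ j
    *%-injective p∤c {i} {j} i<p j<p eq with ≤-total i j
    ... | inj₁ i≤j = *%-injective-≤ p∤c i≤j j<p eq
    ... | inj₂ j≤i = sym (*%-injective-≤ p∤c j≤i i<p (sym eq))

module Tuples where
  open import Data.Nat
  open import Data.List using (List; []; _∷_; map; concatMap; length)
  open import Data.List.Properties using (length-++; length-map)
  open import Data.List.Relation.Unary.All as All using (All; []; _∷_)
  open import Data.List.Relation.Unary.All.Properties using (map⁺; concat⁺)
  import Data.Vec as Vec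
  open import Relation.Binary.PropositionalEquality
  open import Function using (_∘_)
  open Sums

  length-concatMap : ∀ {A B : Set} (f : A → List B) xs → length (concatMap f xs) ≡ ∑ xs (length ∘ f)
  length-concatMap f []       = refl
  length-concatMap f (x ∷ xs) = trans (length-++ (f x)) (cong (length (f x) +_) (length-concatMap f xs))

  length-tuples : ∀ s (xs : List ℕ) → length (tuples s xs) ≡ length xs ^ s
  length-tuples zero    xs = refl
  length-tuples (suc s) xs = begin
    length (concatMap extend xs)       ≡⟨ length-concatMap extend xs ⟩
    ∑ xs (λ x → length (extend x))     ≡⟨ ∑-cong xs (λ x → trans (length-map (x Vec.∷_) (tuples s xs)) (length-tuples s xs)) ⟩
    ∑ xs (λ _ → length xs ^ s)         ≡⟨ ∑-const xs (length xs ^ s) ⟩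
    length xs ^ suc s                  ∎
    where
    open ≡-Reasoning
    extend : ℕ → List (Vec.Vec ℕ (suc s))
    extend x = map (x Vec.∷_) (tuples s xs)

  All-tuples : ∀ {P : ℕ → Set} → P 1 → (∀ {m n} → P m → P n → P (m * n)) →
               ∀ s {xs} → All P xs → All (P ∘ prodV) (tuples s xs)
  All-tuples P1 P* zero    Pxs = P1 ∷ []
  All-tuples P1 P* (suc s) Pxs =
    concat⁺ (map⁺ (All.map (λ Px → map⁺ (All.map (P* Px) (All-tuples P1 P* s Pxs))) Pxs))

module Counting (q : ℕ) (isPrime : Prime (suc (suc q))) where
  open import Data.Nat
  open import Data.Nat.Properties
  open import Data.Nat.DivMod
  open import Data.Nat.Divisibility
  open import Data.List using (List; map; upTo; length)
  open import Data.List.Properties using (length-map; length-upTo)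
  open import Data.List.Relation.Unary.All as All using (All)
  open import Data.List.Relation.Unary.All.Properties using (map⁺; applyUpTo⁺₁)
  open import Data.Vec using (Vec)
  open import Relation.Binary.PropositionalEquality
  open import Relation.Nullary using (yes; no; contradiction)
  open import Function using (_∘_)
  open Sums
  open Fibres
  open Residues
  open Tuples

  p : ℕ
  p = 2 + q

  R : List ℕ
  R = range2 p

  T : (s : ℕ) → List (Vec ℕ s)
  T s = tuples s R

  R-∤ : All (p ∤_) R
  R-∤ = map⁺ (applyUpTo⁺₁ (λ i → i) q (λ i<q → >⇒∤ (s<s (s<s i<q))))

  ∑-R : ∀ (f : ℕ → ℕ) → ∑ R f ≡ ∑< q (λ i → f (2 + i))
  ∑-R f = trans (∑-map (2 +_) (upTo q) f) (∑-upTo q (λ i → f (2 + i)))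

  T-∤ : ∀ s → All (λ t → p ∤ prodV t) (T s)
  T-∤ s = All-tuples (∤1 isPrime) (∤-* isPrime) s R-∤

  length-T : ∀ s → length (T s) ≡ q ^ s
  length-T s = trans (length-tuples s R) (cong (_^ s) (trans (length-map (2 +_) (upTo q)) (length-upTo q)))

  residue : ∀ {s} → Vec ℕ s → ℕ
  residue t = prodV t % p

  residue≢0 : ∀ {s} (t : Vec ℕ s) → p ∤ prodV t → residue t ≢ 0
  residue≢0 t p∤t = p∤t ∘ m%n≡0⇒n∣m (prodV t) p

  count : ℕ → ℕ → ℕ
  count s a = ∑ (T s) (λ t → δ a (residue t))

  unit-fibre : ∀ {a m} → 2 ≤ a → a < p → p ∤ m → ∑ R (λ x → δ a (x * m % p)) + δ a (m % p) ≡ 1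
  unit-fibre {a} {m} (s≤s (s≤s _)) a<p p∤m = begin
    ∑ R (λ x → δ a (x * m % p)) + δ a (m % p)
      ≡⟨ cong₂ _+_ (∑-R _) (cong (λ n → δ a (n % p)) (sym (*-identityˡ m))) ⟩
    ∑< q (λ i → δ a ((2 + i) * m % p)) + δ a (1 * m % p)
      ≡⟨ +-comm _ (δ a (1 * m % p)) ⟩
    -- the term i = 0 of the fibre is δ a (0 * m % p), which computes to 0 as 2 ≤ a
    fibre p (λ i → i * m % p) a
      ≡⟨ injective⇒fibre≡1 p (λ {i} _ → m%n<n (i * m) p) (*%-injective isPrime p∤m) a<p ⟩
    1 ∎
    where open ≡-Reasoning

  count-recurrence : ∀ s {a} → 2 ≤ a → a < p → count (suc s) a + count s a ≡ q ^ s
  count-recurrence s {a} 2≤a a<p = begin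
    count (suc s) a + count s a
      ≡⟨ cong (_+ count s a) (trans (∑-concatMap (λ x → map (x Vec.∷_) (T s)) R _)
                                  (∑-cong R (λ x → ∑-map (x Vec.∷_) (T s) _))) ⟩
    ∑ R (λ x → ∑ (T s) (λ t → δ a (x * prodV t % p))) + count s a
      ≡⟨ cong (_+ count s a) (∑-swap R (T s) _) ⟩
    ∑ (T s) (λ t → ∑ R (λ x → δ a (x * prodV t % p))) + count s a
      ≡⟨ sym (∑-+ (T s) _ _) ⟩
    ∑ (T s) (λ t → ∑ R (λ x → δ a (x * prodV t % p)) + δ a (residue t))
      ≡⟨ ∑-cong-local (All.map (unit-fibre 2≤a a<p) (T-∤ s)) ⟩
    ∑ (T s) (λ _ → 1)
      ≡⟨ ∑-const (T s) 1 ⟩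
    length (T s) * 1
      ≡⟨ trans (*-identityʳ _) (length-T s) ⟩
    q ^ s ∎
    where open ≡-Reasoning

  count-zero : ∀ s → count s 0 ≡ 0
  count-zero s = begin
    count s 0         ≡⟨ ∑-cong-local (All.map (λ {t} p∤t → δ-≢ (residue≢0 t p∤t ∘ sym)) (T-∤ s)) ⟩
    ∑ (T s) (λ _ → 0) ≡⟨ ∑-const (T s) 0 ⟩
    length (T s) * 0  ≡⟨ *-zeroʳ (length (T s)) ⟩
    0                 ∎
    where open ≡-Reasoning

  count-uniform : 2 < p → ∀ s {a} → 2 ≤ a → a < p → count s a ≡ count s 2
  count-uniform 2<p zero    (s≤s (s≤s _)) a<p = refl
  count-uniform 2<p (suc s) {a} 2≤a       a<p = +-cancelʳ-≡ (count s 2) _ _ (begin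
    count (suc s) a + count s 2 ≡⟨ cong (count (suc s) a +_) (sym (count-uniform 2<p s 2≤a a<p)) ⟩
    count (suc s) a + count s a ≡⟨ count-recurrence s 2≤a a<p ⟩
    q ^ s                       ≡⟨ sym (count-recurrence s ≤-refl 2<p) ⟩
    count (suc s) 2 + count s 2 ∎)
    where open ≡-Reasoning

  χ₀-pred : ∀ {m} → p ∤ m → χ₀ p (m ∸ 1) ≡ 1 ∸ δ 1 (m % p)
  χ₀-pred {zero}  p∤0 = contradiction (p ∣0) p∤0
  χ₀-pred {suc k} _ with p ∣? k
  ... | yes p∣k = sym (cong (λ r → 1 ∸ δ 1 r) (%-remove-+ʳ 1 p∣k))
  ... | no  p∤k = cong (1 ∸_) (sym (δ-≢ (p∤k ∘ %-≡⇒∣∸ 1 (suc k))))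

  -- The summand of lhs is local to its where block; unifying against the unfolded sum recovers it.
  summand : ∀ s → Vec ℕ s → Vec ℕ s → ℕ
  summand s = recover refl
    where
    recover : ∀ {f : Vec ℕ s → Vec ℕ s → ℕ} → lhs p s ≡ ∑ (T s) (λ x → ∑ (T s) (f x)) →
              Vec ℕ s → Vec ℕ s → ℕ
    recover {f} _ = f

  summand-δ : ∀ s (x y : Vec ℕ s) → summand s x y ≡ δ (residue x) (residue y) * χ₀ p (prodV x ∸ 1)
  summand-δ s x y with residue x ≟ residue y
  ... | yes residue≡ rewrite residue≡ | δ-refl (residue y) = sym (+-identityʳ _)
  ... | no  residue≢ rewrite δ-≢ residue≢ = refl

  lhs-closed : 2 < p → ∀ s → lhs p s ≡ q * (count s 2 * count s 2)
  lhs-closed 2<p s = begin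
    lhs p s
      ≡⟨ ∑-cong (T s) (λ x → ∑-cong (T s) (summand-δ s x)) ⟩
    ∑ (T s) (λ x → ∑ (T s) (λ y → δ (residue x) (residue y) * χ₀ p (prodV x ∸ 1)))
      ≡⟨ ∑-cong (T s) (λ x → ∑-*ʳ (T s) (λ y → δ (residue x) (residue y)) _) ⟩
    ∑ (T s) (λ x → count s (residue x) * χ₀ p (prodV x ∸ 1))
      ≡⟨ ∑-cong-local (All.map (λ {x} p∤x → cong (count s (residue x) *_) (χ₀-pred p∤x)) (T-∤ s)) ⟩
    ∑ (T s) (λ x → count s (residue x) * (1 ∸ δ 1 (residue x)))
      ≡⟨ ∑-fibres (T s) p residue (λ x → m%n<n (prodV x) p) (λ a → count s a * (1 ∸ δ 1 a)) ⟩
    ∑< p ψ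
      ≡⟨ cong₂ _+_ ψ0≡0 (cong₂ _+_ ψ1≡0 ψ-rest) ⟩
    q * (A * A) ∎
    where
    open ≡-Reasoning
    A : ℕ
    A = count s 2
    ψ : ℕ → ℕ
    ψ a = count s a * (count s a * (1 ∸ δ 1 a))
    ψ0≡0 : ψ 0 ≡ 0
    ψ0≡0 = cong (λ c → c * (c * 1)) (count-zero s)
    ψ1≡0 : ψ 1 ≡ 0
    ψ1≡0 = trans (cong (count s 1 *_) (*-zeroʳ (count s 1))) (*-zeroʳ (count s 1))
    ψ-rest : ∑< q (λ i → ψ (2 + i)) ≡ q * (A * A)
    ψ-rest = trans (∑<-cong q (λ i<q → trans (cong (λ c → c * (c * 1)) (uniform i<q)) (cong (A *_) (*-identityʳ A))))
                   (∑<-const q (A * A))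
      where
      uniform : ∀ {i} → i < q → count s (2 + i) ≡ A
      uniform i<q = count-uniform 2<p s (s≤s (s≤s z≤n)) (s<s (s<s i<q))

module AlternatingRecurrence where
  import Data.Nat as ℕ
  open import Data.Integer
  open import Data.Integer.Properties using (pos-+; pos-*; *-zeroʳ)
  open import Data.Integer.Tactic.RingSolver using (solve-∀)
  open import Relation.Binary.PropositionalEquality

  pos-^ : ∀ n s → + (n ℕ.^ s) ≡ (+ n) ^ s
  pos-^ n ℕ.zero    = refl
  pos-^ n (ℕ.suc s) = trans (pos-* n (n ℕ.^ s)) (cong (+ n *_) (pos-^ n s))

  closed-form-step : ∀ (Q X Y a b : ℤ) → b + a ≡ X → (1ℤ + Q) * a ≡ X - Y → (1ℤ + Q) * b ≡ Q * X - (- + 1) * Y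
  closed-form-step Q X Y a b b+a≡X [1+Q]a≡X-Y = begin
    (1ℤ + Q) * b                         ≡⟨ split Q a b ⟩
    (1ℤ + Q) * (b + a) - (1ℤ + Q) * a    ≡⟨ cong₂ (λ u v → (1ℤ + Q) * u - v) b+a≡X [1+Q]a≡X-Y ⟩
    (1ℤ + Q) * X - (X - Y)               ≡⟨ collect Q X Y ⟩
    Q * X - (- + 1) * Y                  ∎
    where
    open ≡-Reasoning
    split : ∀ Q a b → (1ℤ + Q) * b ≡ (1ℤ + Q) * (b + a) - (1ℤ + Q) * a
    split = solve-∀
    collect : ∀ Q X Y → (1ℤ + Q) * X - (X - Y) ≡ Q * X - (- + 1) * Y
    collect = solve-∀

  closed-form : ∀ q (x : ℕ.ℕ → ℕ.ℕ) → x 0 ≡ 0 → (∀ s → x (ℕ.suc s) ℕ.+ x s ≡ q ℕ.^ s) →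
                ∀ s → + ℕ.suc q * + x s ≡ (+ q) ^ s - (- + 1) ^ s
  closed-form q x x0≡0 rec ℕ.zero    = trans (cong (λ z → + ℕ.suc q * + z) x0≡0) (*-zeroʳ (+ ℕ.suc q))
  closed-form q x x0≡0 rec (ℕ.suc s) =
    closed-form-step (+ q) ((+ q) ^ s) ((- + 1) ^ s) (+ x s) (+ x (ℕ.suc s))
      (trans (sym (pos-+ (x (ℕ.suc s)) (x s))) (trans (cong +_ (rec s)) (pos-^ q s)))
      (closed-form q x x0≡0 rec s)

module Embedding where
  import Data.Nat as ℕ
  open import Data.Integer as ℤ using (+_)
  import Data.Integer.Properties as ℤ
  open import Data.Integer.Tactic.RingSolver using (solve-∀)
  open import Data.Rational using (_/_; _*_; toℚᵘ)
  open import Data.Rational.Properties using (toℚᵘ-injective; toℚᵘ-fromℚᵘ; toℚᵘ-homo-*; fromℚᵘ-cong)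
  import Data.Rational.Unnormalised as ℚᵘ
  import Data.Rational.Unnormalised.Properties as ℚᵘ
  open import Relation.Binary.PropositionalEquality

  /1-* : ∀ i j → (i ℤ.* j) / 1 ≡ (i / 1) * (j / 1)
  /1-* i j = toℚᵘ-injective (begin
    toℚᵘ ((i ℤ.* j) / 1)              ≈⟨ toℚᵘ-fromℚᵘ (ℚᵘ.mkℚᵘ (i ℤ.* j) 0) ⟩
    ℚᵘ.mkℚᵘ i 0 ℚᵘ.* ℚᵘ.mkℚᵘ j 0      ≈⟨ ℚᵘ.*-cong (toℚᵘ-fromℚᵘ (ℚᵘ.mkℚᵘ i 0)) (toℚᵘ-fromℚᵘ (ℚᵘ.mkℚᵘ j 0)) ⟨
    toℚᵘ (i / 1) ℚᵘ.* toℚᵘ (j / 1)    ≈⟨ toℚᵘ-homo-* (i / 1) (j / 1) ⟨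
    toℚᵘ ((i / 1) * (j / 1))          ∎)
    where open ℚᵘ.≃-Reasoning

  +/1-* : ∀ m n → + (m ℕ.* n) / 1 ≡ (+ m / 1) * (+ n / 1)
  +/1-* m n = trans (cong (_/ 1) (ℤ.pos-* m n)) (/1-* (+ m) (+ n))

  *-cancelˡ-/ : ∀ n i → (+ suc n ℤ.* i) / suc n ≡ i / 1
  *-cancelˡ-/ n i =
    fromℚᵘ-cong {ℚᵘ.mkℚᵘ (+ suc n ℤ.* i) n} {ℚᵘ.mkℚᵘ i 0} (ℚᵘ.*≡* (cross-multiply (+ suc n) i))
    where
    cross-multiply : ∀ N i → (N ℤ.* i) ℤ.* + 1 ≡ i ℤ.* N
    cross-multiply = solve-∀

open import Data.Integer using (ℤ; +_; -_)
open import Data.Rational using (ℚ; _/_; _*_)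
open import Relation.Binary.PropositionalEquality using (_≡_)
import Data.Integer as ℤ

import Data.Nat as ℕ
open import Data.Nat.Properties using (≤-refl)
import Data.Rational.Properties as ℚ
open import Relation.Binary.PropositionalEquality using (refl; cong; sym; trans; module ≡-Reasoning)
open AlternatingRecurrence using (closed-form)
open Embedding

-- The identity also holds for s = 0 (both sides vanish).
lemma5p3 : (p s : ℕ) → Prime p → 2 < p → 0 < s →
    (+ lhs p s) / 1
    ≡ ((+ (p ∸ 2)) / 1)
    * ((((+ (p ∸ 2)) ℤ.^ s) ℤ.- ((ℤ.- (+ 1)) ℤ.^ s)) / suc (p ∸ 2))
    * ((((+ (p ∸ 2)) ℤ.^ s) ℤ.- ((ℤ.- (+ 1)) ℤ.^ s)) / suc (p ∸ 2))
lemma5p3 (suc (suc q)) s isPrime 2<p _ = begin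
  (+ lhs (suc (suc q)) s) / 1              ≡⟨ cong (λ n → + n / 1) (lhs-closed 2<p s) ⟩
  + (q ℕ.* (A ℕ.* A)) / 1                  ≡⟨ +/1-* q (A ℕ.* A) ⟩
  (+ q / 1) * (+ (A ℕ.* A) / 1)            ≡⟨ cong ((+ q / 1) *_) (+/1-* A A) ⟩
  (+ q / 1) * ((+ A / 1) * (+ A / 1))      ≡⟨ sym (ℚ.*-assoc (+ q / 1) (+ A / 1) (+ A / 1)) ⟩
  (+ q / 1) * (+ A / 1) * (+ A / 1)        ≡⟨ cong (λ r → (+ q / 1) * r * r) (sym num/[q+1]≡A) ⟩
  (+ q / 1) * (num / suc q) * (num / suc q)    ∎
  where
  open ≡-Reasoning
  open Counting q isPrime
  A : ℕ
  A = count s 2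
  num : ℤ
  num = (+ q) ℤ.^ s ℤ.- (ℤ.- (+ 1)) ℤ.^ s
  num/[q+1]≡A : num / suc q ≡ + A / 1
  num/[q+1]≡A = trans (cong (_/ suc q) (sym [q+1]A≡num)) (*-cancelˡ-/ q (+ A))
    where
    [q+1]A≡num : + suc q ℤ.* + A ≡ num
    [q+1]A≡num = closed-form q (λ s → count s 2) refl (λ s → count-recurrence s ≤-refl 2<p) s
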